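{- Let $R$ be a word rewriting system over $\Sigma$, $L_R$ its associated strictly positive logic and $(L_R)_D$ its deep inference calculus. Let $A,B$ be strictly positive formulas in which $\top$ does not occur. If $A\vdash_{L_R}B$, then there is a derivation of $B$ from $A$ in $(L_R)_D$ in which the $\top$-rule is not applied.
   Context: A word rewriting system $R$ over $\Sigma$ is a set of rules $U\mapsto V$ with $U,V\in\Sigma^*$. Strictly positive formulas (letters of $\Sigma$ as diamonds): $A::= p \mid \top \mid (A\land B)\mid aA$, $a\in\Sigma$. For $U=a_1\cdots a_n$, $UC$ denotes $a_1\cdots a_nC$. The system $\mathbf{K}^+$: $A\vdash A$; $A\vdash\top$; from $A\vdash B$, $B\vdash C$ infer $A\vdash C$; $A\land B\vdash A$; $A\land B\vdash B$; from $A\vdash B$, $A\vdash C$ infer $A\vdash B\land C$; from $A\vdash B$ infer $aA\vdash aB$. $L_R$ is the smallest set of sequents containing the axioms of $\mathbf{K}^+$ and all sequents $UC\vdash VC$ ($U\mapsto V$ in $R$, $C$ any strictly positive formula), closed under the rules of $\mathbf{K}^+$; $A\vdash_{L_R}B$ means $A\vdash B\in L_R$. The deep inference calculus $(L_R)_D$ has the one-premise rules: from $A$ infer $A\land A$ (conjunction introduction); from $A\land B$ infer $A$ and from $A\land B$ infer $B$ (conjunction elimination); from $A$ infer $\top$ (the $\top$-rule); and, for each rule $U\mapsto V$ of $R$ and each formula $C$, from $UC$ infer $VC$. A context is a formula $C(q)$ in which the variable $q$ occurs exactly once; if from $A$ infer $B$ is a rule instance, then $C(B)$ is obtained from $C(A)$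 by a rule application. A derivation of $B$ from $A$ is a finite sequence of formulas starting with $A$, ending with $B$, each later member obtained from the previous one by a rule application. -}

module Defs where

open import Data.List using (List; []; _∷_)
open import Data.Bool using (Bool; true; false)
open import Data.Empty using (⊥)
open import Data.Unit using (⊤)
open import Data.Product using (_×_)

-- Σ : alphabet (the letters, used as diamonds); Var : propositional variables.
-- A rewriting system R is a set of rules U ↦ V, i.e. a predicate on pairs of words.
module _ (Σ : Set) (Var : Set) where

  Word : Set
  Word = List Σ

  RWS : Set₁
  RWS = Word → Word → Set

  data Fm : Set where
    var  : Var → Fm
    tt   : Fm
    _∧_  : Fm → Fm → Fm
    ◇    : Σ → Fm → Fm

  _·_ : Word → Fm → Fm
  [] · C = C
  (a ∷ U) · C = ◇ a (U · C)

  TopFree : Fm → Set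
  TopFree (var p) = ⊤
  TopFree tt = ⊥
  TopFree (A ∧ B) = TopFree A × TopFree B
  TopFree (◇ a A) = TopFree A

  data _⊢[_]_ : Fm → RWS → Fm → Set₁ where
    ax    : ∀ {R A} → A ⊢[ R ] A
    top   : ∀ {R A} → A ⊢[ R ] tt
    cut   : ∀ {R A B C} → A ⊢[ R ] B → B ⊢[ R ] C → A ⊢[ R ] C
    elimˡ : ∀ {R A B} → (A ∧ B) ⊢[ R ] A
    elimʳ : ∀ {R A B} → (A ∧ B) ⊢[ R ] B
    intro : ∀ {R A B C} → A ⊢[ R ] B → A ⊢[ R ] C → A ⊢[ R ] (B ∧ C)
    mono  : ∀ {R A B} (a : Σ) → A ⊢[ R ] B → ◇ a A ⊢[ R ] ◇ a B
    rw    : ∀ {R U V} (C : Fm) → R U V → (U · C) ⊢[ R ] (V · C)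

  -- rule instances of the deep inference calculus (L_R)_D;
  -- the Bool index records whether the instance is a ⊤-rule instance
  data Rule (R : RWS) : Bool → Fm → Fm → Set where
    ∧-intro  : ∀ {A} → Rule R false A (A ∧ A)
    ∧-elimˡ  : ∀ {A B} → Rule R false (A ∧ B) A
    ∧-elimʳ  : ∀ {A B} → Rule R false (A ∧ B) B
    ⊤-rule   : ∀ {A} → Rule R true A tt
    rw-rule  : ∀ {U V} (C : Fm) → R U V → Rule R false (U · C) (V · C)

  data Ctx : Set where
    hole : Ctx
    _∧ₗ_ : Ctx → Fm → Ctx
    _∧ᵣ_ : Fm → Ctx → Ctx
    ◇c   : Σ → Ctx → Ctx

  plug : Ctx → Fm → Fm
  plug hole A = A
  plug (K ∧ₗ B) A = plug K A ∧ B
  plug (B ∧ᵣ K) A = B ∧ plug K A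
  plug (◇c a K) A = ◇ a (plug K A)

  data Step (R : RWS) (t : Bool) : Fm → Fm → Set where
    step : ∀ {A B} (K : Ctx) → Rule R t A B → Step R t (plug K A) (plug K B)

  StepNoTop : RWS → Fm → Fm → Set
  StepNoTop R = Step R false

  data DerivNoTop (R : RWS) : Fm → Fm → Set where
    done : ∀ {A} → DerivNoTop R A A
    _∷ᵈ_ : ∀ {A B C} → StepNoTop R A B → DerivNoTop R B C → DerivNoTop R A C

module Submission where

-- A cut-free style translation of L_R-proofs into deep-inference
-- derivations fails only at the axiom A ⊢ ⊤, which needs the ⊤-rule.  We
-- avoid it by never producing ⊤: say that A* refines A (A* ⊑ A) when A arises
-- from A* by replacing some subformulas by ⊤.  The key lemma `simulate` shows,
-- by induction on a proof of A ⊢ B, that every ⊤-free refinement A* of A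
-- derives, without the ⊤-rule, some ⊤-free refinement B* of B; the axiom
-- A ⊢ ⊤ is then witnessed by B* = A* and the empty derivation.  When B itself
-- is ⊤-free its only refinement is B, which gives the theorem.

open import Defs
open import Data.Bool using (false)
open import Data.List using ([]; _∷_)
open import Data.Product using (_,_)
open import Relation.Binary.PropositionalEquality using (_≡_; refl; subst; cong; cong₂)

module _ {Σ Var : Set} where

  private
    Form : Set
    Form = Fm Σ Var

    _⊙_ : Word Σ Var → Form → Form
    U ⊙ C = _·_ Σ Var U C

    TopFree′ : Form → Set
    TopFree′ = TopFree Σ Var

  infix 4 _⊑_
  data _⊑_ : Form → Form → Set where
    ⊑-⊤   : ∀ {A*} → A* ⊑ tt
    ⊑-var : ∀ {p} → var p ⊑ var p
    ⊑-∧   : ∀ {A* B* A B} → A* ⊑ A → B* ⊑ B → (A* ∧ B*) ⊑ (A ∧ B)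
    ⊑-◇   : ∀ {a A* A} → A* ⊑ A → ◇ a A* ⊑ ◇ a A

  ⊑-refl : (A : Form) → A ⊑ A
  ⊑-refl (var p) = ⊑-var
  ⊑-refl tt      = ⊑-⊤
  ⊑-refl (A ∧ B) = ⊑-∧ (⊑-refl A) (⊑-refl B)
  ⊑-refl (◇ a A) = ⊑-◇ (⊑-refl A)

  ⊑-topFree-≡ : ∀ {A* A} → TopFree′ A → A* ⊑ A → A* ≡ A
  ⊑-topFree-≡ ()        ⊑-⊤
  ⊑-topFree-≡ _         ⊑-var     = refl
  ⊑-topFree-≡ (tA , tB) (⊑-∧ r s) = cong₂ _∧_ (⊑-topFree-≡ tA r) (⊑-topFree-≡ tB s)
  ⊑-topFree-≡ tA        (⊑-◇ r)   = cong (◇ _) (⊑-topFree-≡ tA r)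

  ⊑-· : (U : Word Σ Var) {C* C : Form} → C* ⊑ C → (U ⊙ C*) ⊑ (U ⊙ C)
  ⊑-· []      r = r
  ⊑-· (a ∷ U) r = ⊑-◇ (⊑-· U r)

  -- Conversely, a refinement of U C again has the shape U C* with C* ⊑ C;
  -- this is what lets a rewrite rule U ↦ V act on a refinement.
  record Prefixed (A* : Form) (U : Word Σ Var) (C : Form) : Set where
    constructor prefixed
    field
      body    : Form
      shape   : A* ≡ U ⊙ body
      refines : body ⊑ C

  ⊑-·-inv : (U : Word Σ Var) {C A* : Form} → A* ⊑ U ⊙ C → Prefixed A* U C
  ⊑-·-inv []      {A* = A*} r = prefixed A* refl r
  ⊑-·-inv (a ∷ U) (⊑-◇ r) with ⊑-·-inv U r
  ... | prefixed C* refl r′ = prefixed C* refl r′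

  topFree-·⁻ : (U : Word Σ Var) {C : Form} → TopFree′ (U ⊙ C) → TopFree′ C
  topFree-·⁻ []      t = t
  topFree-·⁻ (a ∷ U) t = topFree-·⁻ U t

  topFree-· : (U : Word Σ Var) {C : Form} → TopFree′ C → TopFree′ (U ⊙ C)
  topFree-· []      t = t
  topFree-· (a ∷ U) t = topFree-· U t

  module _ {R : RWS Σ Var} where

    infix 4 _⇒_
    _⇒_ : Form → Form → Set
    _⇒_ = DerivNoTop Σ Var R

    infixr 5 _++ᵈ_
    _++ᵈ_ : ∀ {A B C} → A ⇒ B → B ⇒ C → A ⇒ C
    done     ++ᵈ e = e
    (s ∷ᵈ d) ++ᵈ e = s ∷ᵈ (d ++ᵈ e)

    atRoot : ∀ {A B} → Rule Σ Var R false A B → A ⇒ B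
    atRoot r = step hole r ∷ᵈ done

    inLeft : ∀ {A B} (C : Form) → A ⇒ B → A ∧ C ⇒ B ∧ C
    inLeft C done               = done
    inLeft C (step K r ∷ᵈ d)    = step (K ∧ₗ C) r ∷ᵈ inLeft C d

    inRight : ∀ {A B} (C : Form) → A ⇒ B → C ∧ A ⇒ C ∧ B
    inRight C done              = done
    inRight C (step K r ∷ᵈ d)   = step (C ∧ᵣ K) r ∷ᵈ inRight C d

    inDiamond : ∀ {A B} (a : Σ) → A ⇒ B → ◇ a A ⇒ ◇ a B
    inDiamond a done            = done
    inDiamond a (step K r ∷ᵈ d) = step (◇c a K) r ∷ᵈ inDiamond a d

    pairDeriv : ∀ {A B C} → A ⇒ B → A ⇒ C → A ⇒ B ∧ C
    pairDeriv {A} {B} d e = atRoot ∧-intro ++ᵈ inLeft A d ++ᵈ inRight B e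

    record Reaches (A* B : Form) : Set where
      constructor reaches
      field
        target     : Form
        topFree    : TopFree′ target
        refines    : target ⊑ B
        derivation : A* ⇒ target

    simulate : ∀ {A B} → _⊢[_]_ Σ Var A R B →
               ∀ {A*} → TopFree′ A* → A* ⊑ A → Reaches A* B
    simulate ax         t r         = reaches _ t r done
    simulate top        t r         = reaches _ t ⊑-⊤ done
    simulate (cut p q)  t r with simulate p t r
    ... | reaches B* tB rB d with simulate q tB rB
    ... | reaches C* tC rC e        = reaches C* tC rC (d ++ᵈ e)
    simulate elimˡ      (t , _) (⊑-∧ r _) = reaches _ t r (atRoot ∧-elimˡ)
    simulate elimʳ      (_ , t) (⊑-∧ _ r) = reaches _ t r (atRoot ∧-elimʳ)
    simulate (intro p q) t r with simulate p t r | simulate q t r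
    ... | reaches B* tB rB d | reaches C* tC rC e =
      reaches (B* ∧ C*) (tB , tC) (⊑-∧ rB rC) (pairDeriv d e)
    simulate (mono a p) t (⊑-◇ r) with simulate p t r
    ... | reaches B* tB rB d        = reaches (◇ a B*) tB (⊑-◇ rB) (inDiamond a d)
    simulate (rw {U = U} {V = V} C u) t r with ⊑-·-inv U r
    ... | prefixed C* refl rC =
      reaches (V ⊙ C*) (topFree-· V (topFree-·⁻ U t)) (⊑-· V rC) (atRoot (rw-rule C* u))

mainTheorem6 : (Σ Var : Set) (R : RWS Σ Var) (A B : Fm Σ Var) →
    TopFree Σ Var A → TopFree Σ Var B →
    _⊢[_]_ Σ Var A R B → DerivNoTop Σ Var R A B
mainTheorem6 Σ Var R A B topFreeA topFreeB proof
  with simulate proof topFreeA (⊑-refl A)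
... | reaches B* _ B*⊑B derivation =
  subst (DerivNoTop Σ Var R A) (⊑-topFree-≡ topFreeB B*⊑B) derivation
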